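{- There is a constant $d>0$ such that for every natural number $n$ there are at least $\lfloor 2^n/d \rfloor$ binary strings $x$ of length $n$ with $C(x\mid n) \geq n$; likewise, there is a constant $d>0$ such that for every $n$ there are at least $\lfloor 2^n/d\rfloor$ binary strings $x$ of length $n$ with $C(x) \geq n$.
   Context: Fix a standard enumeration $T_0,T_1,\ldots$ of Turing machines and a universal Turing machine $U$ with $U(\langle\langle i,p\rangle,y\rangle)=T_i(\langle p,y\rangle)$, where $\langle\cdot,\cdot\rangle$ is a standard one-to-one pairing of strings. The conditional Kolmogorov complexity is $C(x\mid y)=\min\{l(p): U(\langle p,y\rangle)=x\}$, where $l(p)$ is the length of the binary string $p$, and $C(x)=C(x\mid\epsilon)$ with $\epsilon$ the empty string. Natural numbers are identified with binary strings via the length-increasing lexicographic order ($\epsilon\mapsto 0$, $0\mapsto 1$, $1\mapsto 2$, $00\mapsto 3,\ldots$), so $C(x\mid n)$ makes sense. -}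

module Defs where

open import Data.Nat using (ℕ; zero; suc; _≤_; _^_; NonZero)
open import Data.Nat.DivMod using (_/_)
open import Data.Bool using (Bool; true; false)
open import Data.List using (List; []; _∷_; _++_; length; replicate; reverse)
open import Data.List.Relation.Unary.All using (All)
open import Data.List.Relation.Unary.Unique.Propositional using (Unique)
open import Data.Maybe using (Maybe; just; nothing)
open import Data.Fin using (Fin)
open import Data.Vec using (Vec; lookup)
open import Data.Product using (Σ; ∃; _×_; _,_)
open import Relation.Binary.PropositionalEquality using (_≡_)
open import Relation.Nullary using (¬_)

-- Binary strings and the identification ℕ ≅ strings
-- (length-increasing lexicographic order: ε ↦ 0, 0 ↦ 1, 1 ↦ 2, 00 ↦ 3, …)

Str : Set
Str = List Bool

-- successor in the length-lexicographic order, acting on the string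
-- written least-significant-bit first (string x corresponds to the
-- binary number 1x minus 1).
incRev : Str → Str
incRev []           = false ∷ []
incRev (false ∷ xs) = true ∷ xs
incRev (true ∷ xs)  = false ∷ incRev xs

natRev : ℕ → Str
natRev zero    = []
natRev (suc n) = incRev (natRev n)

natStr : ℕ → Str
natStr n = reverse (natRev n)

bar : Str → Str
bar x = replicate (length x) true ++ (false ∷ x)

⟨_,_⟩ : Str → Str → Str
⟨ x , y ⟩ = bar x ++ y

-- Turing machines (one tape, alphabet {blank,0,1}, state 0 is initial)

data Sym : Set where
  blank b0 b1 : Sym

symIx : Sym → Fin 3
symIx blank = Fin.zero
symIx b0    = Fin.suc Fin.zero
symIx b1    = Fin.suc (Fin.suc Fin.zero)

data Move : Set where
  L R : Move

-- an action: nothing = halt; just (q' , s , m) = write s, go to q', move m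
Action : ℕ → Set
Action q = Maybe (Fin (suc q) × Sym × Move)

record TM : Set where
  constructor tm
  field
    nstates : ℕ
    table   : Vec (Vec (Action nstates) 3) (suc nstates)

-- configuration: state, left part (nearest cell first), head symbol, right part
record Config (q : ℕ) : Set where
  constructor cfg
  field
    state : Fin (suc q)
    left  : List Sym
    head  : Sym
    right : List Sym

bitSym : Bool → Sym
bitSym false = b0
bitSym true  = b1

initConfig : (q : ℕ) → Str → Config q
initConfig q []       = cfg Fin.zero [] blank []
initConfig q (b ∷ bs) = cfg Fin.zero [] (bitSym b) (Data.List.map bitSym bs)

moveTape : Move → List Sym → Sym → List Sym → (List Sym × Sym × List Sym)
moveTape L []       s r = ([] , blank , s ∷ r)
moveTape L (a ∷ l)  s r = (l , a , s ∷ r)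
moveTape R l s []       = (s ∷ l , blank , [])
moveTape R l s (a ∷ r)  = (s ∷ l , a , r)

apply : {q : ℕ} → (Fin (suc q) × Sym × Move) → Config q → Config q
apply (q' , s , m) (cfg _ l _ r) with moveTape m l s r
... | (l' , h' , r') = cfg q' l' h' r'

action : (M : TM) → Config (TM.nstates M) → Action (TM.nstates M)
action M (cfg st _ h _) = lookup (lookup (TM.table M) st) (symIx h)

-- run for at most k steps; just c if the machine has halted in configuration c
run : (M : TM) → ℕ → Config (TM.nstates M) → Maybe (Config (TM.nstates M))
run M k c with action M c
... | nothing = just c
run M zero    c | just a = nothing
run M (suc k) c | just a = run M k (apply a c)

-- output: maximal 0/1 string starting at the head position
readBits : List Sym → Str
readBits []          = []
readBits (blank ∷ _) = []
readBits (b0 ∷ r)    = false ∷ readBits r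
readBits (b1 ∷ r)    = true ∷ readBits r

output : {q : ℕ} → Config q → Str
output (cfg _ _ h r) = readBits (h ∷ r)

Computes : TM → Str → Str → Set
Computes M w x = ∃ λ k → Data.Maybe.map output (run M k (initConfig (TM.nstates M) w)) ≡ just x

Enumeration : Set
Enumeration = ℕ → TM

EnumeratesAll : Enumeration → Set
EnumeratesAll T = (M : TM) → ∃ λ i → T i ≡ M

UComputes : Enumeration → Str → Str → Set
UComputes T z x = ∃ λ i → ∃ λ p → ∃ λ y →
  (z ≡ ⟨ ⟨ natStr i , p ⟩ , y ⟩) × Computes (T i) ⟨ p , y ⟩ x

-- C(x | y) ≥ n, i.e. every p with U(⟨p,y⟩) = x has l(p) ≥ n
-- (unfolding of  min{ l(p) : U(⟨p,y⟩) = x } ≥ n)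
CGeq : Enumeration → Str → Str → ℕ → Set
CGeq T x y n = (p : Str) → UComputes T ⟨ p , y ⟩ x → n ≤ length p

-- "there are at least ⌊2^n/d⌋ strings x of length n with C(x|y) ≥ n",
-- stated classically (double negation) since the set is not decidable
ManyIncompressible : Enumeration → (d : ℕ) → .{{NonZero d}} → (n : ℕ) → (y : Str) → Set
ManyIncompressible T d n y =
  ¬ ¬ (Σ (List Str) λ xs →
        Unique xs × All (λ x → (length x ≡ n) × CGeq T x y n) xs
        × (2 ^ n) / d ≤ length xs)

-- A string x of length n with C(x | y) < n has a program of length < n, and
-- since U is deterministic, distinct such x have distinct programs. There are
-- at most 2^n strings of length < n, and 2^m of them are wasted whenever
-- k + m < n, where k = l(bar i) for an index i of a machine that never halts:
-- the programs ⟨i , w⟩ with l(w) = m compute nothing. So at least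
-- 2^m = ⌊2^n / 2^{k+1}⌋ strings of length n are incompressible (take
-- m = n − k − 1; for smaller n the bound is 0). Only the split of the strings
-- of length n into compressible and incompressible ones is classical.
module Submission where

open import Defs
open import Data.Bool using (true; false)
open import Data.Empty using (⊥-elim)
open import Data.Fin using (Fin; zero)
open import Data.List using (List; []; _∷_; _++_; length; map; replicate; splitAt)
import Data.List.Fresh as Fresh
open import Data.List.Fresh.Relation.Unary.Any using (here; there)
import Data.List.Fresh.Membership.Setoid as FreshMembership
import Data.List.Fresh.Membership.Setoid.Properties as FreshMembershipProperties
open import Data.List.Membership.Propositional using (_∈_)
open import Data.List.Membership.Propositional.Properties using (∈-map⁻; ∈-upTo⁺)
open import Data.List.Properties
  using (++-assoc; ++-cancelˡ; ∷-injectiveʳ; length-++; length-map; length-upTo; reverse-injective)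
open import Data.List.Relation.Binary.Disjoint.Propositional using (Disjoint)
open import Data.List.Relation.Unary.All as All using (All; []; _∷_)
import Data.List.Relation.Unary.All.Properties as All
open import Data.List.Relation.Unary.AllPairs using ([]; _∷_)
import Data.List.Relation.Unary.Any as Any
open import Data.List.Relation.Unary.Unique.Propositional using (Unique)
import Data.List.Relation.Unary.Unique.Propositional.Properties as Unique
open import Data.Maybe using (just; nothing) renaming (map to mapMaybe)
open import Data.Maybe.Properties using (just-injective)
open import Data.Nat
open import Data.Nat.DivMod using (_/_; m*n/n≡m; m<n⇒m/n≡0)
open import Data.Nat.Properties
open import Data.Product using (Σ; ∃; _×_; _,_; proj₁; proj₂; map₁; map₂; uncurry)
open import Data.Product.Properties using (,-injective)
open import Data.Vec using ([]; _∷_)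
open import Function using (_∘_; id)
open import Level using (0ℓ)
open import Relation.Binary.PropositionalEquality
open import Relation.Nullary using (¬_; Dec; yes; no)
open import Relation.Nullary.Decidable using (decidable-stable; ¬¬-excluded-middle)
open import Relation.Nullary.Negation using (¬¬-Monad; ¬¬-map)

revToℕ : Str → ℕ
revToℕ []          = 0
revToℕ (false ∷ x) = 1 + 2 * revToℕ x
revToℕ (true ∷ x)  = 2 + 2 * revToℕ x

revToℕ-incRev : ∀ x → revToℕ (incRev x) ≡ suc (revToℕ x)
revToℕ-incRev []          = refl
revToℕ-incRev (false ∷ x) = refl
revToℕ-incRev (true ∷ x)  = cong suc (trans (cong (2 *_) (revToℕ-incRev x)) (*-suc 2 (revToℕ x)))

revToℕ-natRev : ∀ n → revToℕ (natRev n) ≡ n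
revToℕ-natRev zero    = refl
revToℕ-natRev (suc n) = trans (revToℕ-incRev (natRev n)) (cong suc (revToℕ-natRev n))

revToℕ-injective : ∀ {x y} → revToℕ x ≡ revToℕ y → x ≡ y
revToℕ-injective {[]}        {[]}        _  = refl
revToℕ-injective {false ∷ x} {false ∷ y} eq =
  cong (false ∷_) (revToℕ-injective (*-cancelˡ-≡ (revToℕ x) (revToℕ y) 2 (suc-injective eq)))
revToℕ-injective {true ∷ x}  {true ∷ y}  eq =
  cong (true ∷_) (revToℕ-injective
    (*-cancelˡ-≡ (revToℕ x) (revToℕ y) 2 (suc-injective (suc-injective eq))))
revToℕ-injective {[]}        {false ∷ _} ()
revToℕ-injective {[]}        {true ∷ _}  ()
revToℕ-injective {false ∷ _} {[]}        ()
revToℕ-injective {true ∷ _}  {[]}        ()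
revToℕ-injective {false ∷ x} {true ∷ y}  eq =
  ⊥-elim (even≢odd (revToℕ x) (revToℕ y) (suc-injective eq))
revToℕ-injective {true ∷ x}  {false ∷ y} eq =
  ⊥-elim (even≢odd (revToℕ y) (revToℕ x) (sym (suc-injective eq)))

-- revToℕ takes the values 2^l − 1, …, 2^{l+1} − 2 on strings of length l.
2+revToℕ≤2^[1+length] : ∀ x → 2 + revToℕ x ≤ 2 ^ suc (length x)
4+2*revToℕ≤2^[2+length] : ∀ x → 4 + 2 * revToℕ x ≤ 2 ^ suc (suc (length x))

2+revToℕ≤2^[1+length] []          = ≤-refl
2+revToℕ≤2^[1+length] (false ∷ x) = ≤-trans (n≤1+n _) (4+2*revToℕ≤2^[2+length] x)
2+revToℕ≤2^[1+length] (true ∷ x)  = 4+2*revToℕ≤2^[2+length] x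

4+2*revToℕ≤2^[2+length] x = ≤-trans (≤-reflexive (sym (*-distribˡ-+ 2 2 (revToℕ x))))
                                     (*-monoʳ-≤ 2 (2+revToℕ≤2^[1+length] x))

revToℕ-< : ∀ {n x} → length x < n → revToℕ x < 2 ^ n
revToℕ-< {x = x} |x|<n =
  ≤-trans (n≤1+n _) (≤-trans (2+revToℕ≤2^[1+length] x) (^-monoʳ-≤ 2 |x|<n))

natStr-injective : ∀ {i j} → natStr i ≡ natStr j → i ≡ j
natStr-injective {i} {j} eq = begin
  i                  ≡⟨ revToℕ-natRev i ⟨
  revToℕ (natRev i)  ≡⟨ cong revToℕ (reverse-injective {x = natRev i} {natRev j} eq) ⟩
  revToℕ (natRev j)  ≡⟨ revToℕ-natRev j ⟩
  j                  ∎
  where open ≡-Reasoning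

leadingOnes : Str → ℕ × Str
leadingOnes (true ∷ s)  = map₁ suc (leadingOnes s)
leadingOnes (false ∷ s) = 0 , s
leadingOnes []          = 0 , []

unpair : Str → Str × Str
unpair = uncurry splitAt ∘ leadingOnes

leadingOnes-1ᵏ0 : ∀ k s → leadingOnes (replicate k true ++ false ∷ s) ≡ (k , s)
leadingOnes-1ᵏ0 zero    s = refl
leadingOnes-1ᵏ0 (suc k) s = cong (map₁ suc) (leadingOnes-1ᵏ0 k s)

splitAt-length-++ : ∀ (x y : Str) → splitAt (length x) (x ++ y) ≡ (x , y)
splitAt-length-++ []      y = refl
splitAt-length-++ (b ∷ x) y = cong (map₁ (b ∷_)) (splitAt-length-++ x y)

unpair-⟨,⟩ : ∀ x y → unpair ⟨ x , y ⟩ ≡ (x , y)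
unpair-⟨,⟩ x y = begin
  uncurry splitAt (leadingOnes ((replicate (length x) true ++ false ∷ x) ++ y))
    ≡⟨ cong (uncurry splitAt ∘ leadingOnes) (++-assoc (replicate (length x) true) (false ∷ x) y) ⟩
  uncurry splitAt (leadingOnes (replicate (length x) true ++ false ∷ x ++ y))
    ≡⟨ cong (uncurry splitAt) (leadingOnes-1ᵏ0 (length x) (x ++ y)) ⟩
  splitAt (length x) (x ++ y)
    ≡⟨ splitAt-length-++ x y ⟩
  (x , y) ∎
  where open ≡-Reasoning

⟨,⟩-injective : ∀ {x y x′ y′} → ⟨ x , y ⟩ ≡ ⟨ x′ , y′ ⟩ → x ≡ x′ × y ≡ y′
⟨,⟩-injective {x} {y} {x′} {y′} eq =
  ,-injective (trans (sym (unpair-⟨,⟩ x y)) (trans (cong unpair eq) (unpair-⟨,⟩ x′ y′)))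

strings : ℕ → List Str
strings zero    = [] ∷ []
strings (suc n) = map (false ∷_) (strings n) ++ map (true ∷_) (strings n)

strings-unique : ∀ n → Unique (strings n)
strings-unique zero    = [] ∷ []
strings-unique (suc n) = Unique.++⁺ (Unique.map⁺ ∷-injectiveʳ (strings-unique n))
                                    (Unique.map⁺ ∷-injectiveʳ (strings-unique n)) disjoint
  where
  disjoint : Disjoint (map (false ∷_) (strings n)) (map (true ∷_) (strings n))
  disjoint (x∈₀ , x∈₁) with ∈-map⁻ (false ∷_) x∈₀ | ∈-map⁻ (true ∷_) x∈₁
  ... | _ , _ , refl | _ , _ , ()

strings-length : ∀ n → All (λ x → length x ≡ n) (strings n)
strings-length zero    = refl ∷ []
strings-length (suc n) = All.++⁺ (All.map⁺ (All.map (cong suc) (strings-length n)))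
                                 (All.map⁺ (All.map (cong suc) (strings-length n)))

length-strings : ∀ n → length (strings n) ≡ 2 ^ n
length-strings zero    = refl
length-strings (suc n) = begin
  length (map (false ∷_) (strings n) ++ map (true ∷_) (strings n))
    ≡⟨ length-++ (map (false ∷_) (strings n)) ⟩
  length (map (false ∷_) (strings n)) + length (map (true ∷_) (strings n))
    ≡⟨ cong₂ _+_ (length-map _ (strings n)) (length-map _ (strings n)) ⟩
  length (strings n) + length (strings n)
    ≡⟨ cong₂ _+_ (length-strings n) (trans (length-strings n) (sym (+-identityʳ _))) ⟩
  2 ^ suc n ∎
  where open ≡-Reasoning

module _ {A : Set} where
  open FreshMembership (setoid A) renaming (_∈_ to _∈#_)
  open FreshMembershipProperties (setoid A) using (injection)

  private
    length-fromList : ∀ {xs : List A} (u : Unique xs) → Fresh.length (Fresh.fromList u) ≡ length xs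
    length-fromList []      = refl
    length-fromList (_ ∷ u) = cong suc (length-fromList u)

    ∈-fromList⁻ : ∀ {x : A} {xs} (u : Unique xs) → x ∈# Fresh.fromList u → x ∈ xs
    ∈-fromList⁻ (_ ∷ _) (here x≡y) = Any.here x≡y
    ∈-fromList⁻ (_ ∷ u) (there x∈) = Any.there (∈-fromList⁻ u x∈)

    ∈-fromList⁺ : ∀ {x : A} {xs} (u : Unique xs) → x ∈ xs → x ∈# Fresh.fromList u
    ∈-fromList⁺ (_ ∷ _) (Any.here x≡y) = here x≡y
    ∈-fromList⁺ (_ ∷ u) (Any.there x∈) = there (∈-fromList⁺ u x∈)

  Unique-⊆⇒length≤ : ∀ {xs ys : List A} → Unique xs → Unique ys →
                     (∀ {x} → x ∈ xs → x ∈ ys) → length xs ≤ length ys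
  Unique-⊆⇒length≤ {xs} {ys} xs-unique ys-unique xs⊆ys = begin
    length xs                                ≡⟨ length-fromList xs-unique ⟨
    Fresh.length (Fresh.fromList xs-unique)  ≤⟨ injection id fresh-⊆ ⟩
    Fresh.length (Fresh.fromList ys-unique)  ≡⟨ length-fromList ys-unique ⟩
    length ys                                ∎
    where
    open ≤-Reasoning
    fresh-⊆ : ∀ {x} → x ∈# Fresh.fromList xs-unique → x ∈# Fresh.fromList ys-unique
    fresh-⊆ = ∈-fromList⁺ ys-unique ∘ xs⊆ys ∘ ∈-fromList⁻ xs-unique

Unique-All<⇒length≤ : ∀ {ks b} → Unique ks → All (_< b) ks → length ks ≤ b
Unique-All<⇒length≤ {ks} {b} ks-unique ks<b =
  ≤-trans (Unique-⊆⇒length≤ ks-unique (Unique.upTo⁺ b) (∈-upTo⁺ ∘ All.lookup ks<b))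
          (≤-reflexive (length-upTo b))

Unique-shorter⇒length≤2^ : ∀ {n qs} → Unique qs → All (λ q → length q < n) qs → length qs ≤ 2 ^ n
Unique-shorter⇒length≤2^ {n} {qs} qs-unique qs-short = begin
  length qs               ≡⟨ length-map revToℕ qs ⟨
  length (map revToℕ qs)  ≤⟨ Unique-All<⇒length≤ (Unique.map⁺ revToℕ-injective qs-unique)
                               (All.map⁺ (All.map (λ {q} → revToℕ-< {x = q}) qs-short)) ⟩
  2 ^ n                   ∎
  where open ≤-Reasoning

prefix-avoiding-bound : ∀ {n m} (s : Str) {ps} → length s + m < n → Unique ps →
  All (λ p → length p < n × (∀ w → p ≢ s ++ w)) ps → length ps + 2 ^ m ≤ 2 ^ n
prefix-avoiding-bound {n} {m} s {ps} s+m<n ps-unique ps-avoid = begin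
  length ps + 2 ^ m           ≡⟨ cong (length ps +_) length-blocked ⟨
  length ps + length blocked  ≡⟨ length-++ ps ⟨
  length (ps ++ blocked)      ≤⟨ Unique-shorter⇒length≤2^
                                   (Unique.++⁺ ps-unique blocked-unique disjoint)
                                   (All.++⁺ (All.map proj₁ ps-avoid) blocked-short) ⟩
  2 ^ n                       ∎
  where
  open ≤-Reasoning
  blocked : List Str
  blocked = map (s ++_) (strings m)
  length-blocked : length blocked ≡ 2 ^ m
  length-blocked = trans (length-map (s ++_) (strings m)) (length-strings m)
  blocked-unique : Unique blocked
  blocked-unique = Unique.map⁺ (++-cancelˡ s _ _) (strings-unique m)
  blocked-short : All (λ q → length q < n) blocked
  blocked-short = All.map⁺ (All.map short (strings-length m))
    where
    short : ∀ {w} → length w ≡ m → length (s ++ w) < n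
    short |w|≡m = subst (_< n) (sym (trans (length-++ s) (cong (length s +_) |w|≡m))) s+m<n
  disjoint : Disjoint ps blocked
  disjoint (p∈ps , p∈blocked) with ∈-map⁻ (s ++_) p∈blocked
  ... | w , _ , refl = proj₂ (All.lookup ps-avoid p∈ps) w refl

run-deterministic : ∀ M k k′ c {c₁ c₂} → run M k c ≡ just c₁ → run M k′ c ≡ just c₂ → c₁ ≡ c₂
run-deterministic M k k′ c halt halt′ with action M c
run-deterministic M k       k′       c halt halt′ | nothing =
  trans (sym (just-injective halt)) (just-injective halt′)
run-deterministic M (suc k) (suc k′) c halt halt′ | just a  =
  run-deterministic M k k′ (apply a c) halt halt′

Computes-functional : ∀ M {w x x′} → Computes M w x → Computes M w x′ → x ≡ x′
Computes-functional M {w} {x} {x′} (k , out) (k′ , out′)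
  with run M k (initConfig _ w) in halt | run M k′ (initConfig _ w) in halt′
... | just c | just c′ = begin
  x          ≡⟨ just-injective out ⟨
  output c   ≡⟨ cong output (run-deterministic M k k′ _ halt halt′) ⟩
  output c′  ≡⟨ just-injective out′ ⟩
  x′         ∎
  where open ≡-Reasoning

UComputes-functional : ∀ T {z x x′} → UComputes T z x → UComputes T z x′ → x ≡ x′
UComputes-functional T (i , p , y , eq , comp) (i′ , p′ , y′ , eq′ , comp′)
  with ⟨,⟩-injective {⟨ natStr i , p ⟩} {y} {⟨ natStr i′ , p′ ⟩} {y′} (trans (sym eq) eq′)
... | eq₁ , refl with ⟨,⟩-injective {natStr i} {p} {natStr i′} {p′} eq₁
... | eq₂ , refl with natStr-injective {i} {i′} eq₂
... | refl = Computes-functional (T i) comp comp′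

moveRight : Fin 1 × Sym × Move
moveRight = zero , blank , R

loop : TM
loop = tm 0 ((just moveRight ∷ just moveRight ∷ just moveRight ∷ []) ∷ [])

run-loop : ∀ k c → run loop k c ≡ nothing
run-loop zero    (cfg zero _ blank _) = refl
run-loop zero    (cfg zero _ b0    _) = refl
run-loop zero    (cfg zero _ b1    _) = refl
run-loop (suc k) c@(cfg zero _ blank _) = run-loop k (apply moveRight c)
run-loop (suc k) c@(cfg zero _ b0    _) = run-loop k (apply moveRight c)
run-loop (suc k) c@(cfg zero _ b1    _) = run-loop k (apply moveRight c)

¬Computes-loop : ∀ {w x} → ¬ Computes loop w x
¬Computes-loop {w} (k , out)
  with () ← trans (sym (cong (mapMaybe output) (run-loop k (initConfig 0 w)))) out

¬UComputes-loopPrefixed : ∀ T {i w y x} → T i ≡ loop → ¬ UComputes T ⟨ ⟨ natStr i , w ⟩ , y ⟩ x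
¬UComputes-loopPrefixed T {i} {w} Ti≡loop (j , p , y′ , eq , comp)
  with ⟨,⟩-injective {y′ = y′} eq
... | eq₁ , _ with ⟨,⟩-injective {natStr i} {w} {natStr j} {p} eq₁
... | eq₂ , _ with natStr-injective {i} {j} eq₂
... | refl = ¬Computes-loop {⟨ p , y′ ⟩} (subst (λ M → Computes M _ _) Ti≡loop comp)

module _ {A B : Set} (R : B → A → Set) where

  Described : A → Set
  Described x = ∃ λ p → R p x

  record Partition (xs : List A) : Set where
    field
      undescribed            : List A
      undescribed-unique     : Unique undescribed
      undescribed-∈          : All (_∈ xs) undescribed
      undescribed-¬described : All (¬_ ∘ Described) undescribed
      descriptions           : List B
      descriptions-unique    : Unique descriptions
      descriptions-describe  : All (λ p → ∃ λ x → x ∈ xs × R p x) descriptions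
      length-partition       : length undescribed + length descriptions ≡ length xs

  partition : (∀ {p x x′} → R p x → R p x′ → x ≡ x′) →
              ∀ {xs} → Unique xs → All (Dec ∘ Described) xs → Partition xs
  partition _ [] [] = record
    { undescribed = [] ; undescribed-unique = [] ; undescribed-∈ = [] ; undescribed-¬described = []
    ; descriptions = [] ; descriptions-unique = [] ; descriptions-describe = [] ; length-partition = refl }
  partition functional {x ∷ xs} (x≢xs ∷ xs-unique) (x? ∷ xs?) with partition functional xs-unique xs?
  ... | P with x?
  ...   | yes (p , Rpx) = record
    { undescribed            = undescribed
    ; undescribed-unique     = undescribed-unique
    ; undescribed-∈          = All.map Any.there undescribed-∈
    ; undescribed-¬described = undescribed-¬described
    ; descriptions           = p ∷ descriptions
    ; descriptions-unique    = All.map p-new descriptions-describe ∷ descriptions-unique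
    ; descriptions-describe  = (x , Any.here refl , Rpx)
                               ∷ All.map (map₂ (map₁ Any.there)) descriptions-describe
    ; length-partition       = trans (+-suc _ _) (cong suc length-partition)
    }
    where
    open Partition P
    p-new : ∀ {p′} → (∃ λ x′ → x′ ∈ xs × R p′ x′) → p ≢ p′
    p-new (x′ , x′∈xs , Rp′x′) refl = All.lookup x≢xs x′∈xs (functional Rpx Rp′x′)
  ...   | no ¬described = record
    { undescribed            = x ∷ undescribed
    ; undescribed-unique     = All.map (All.lookup x≢xs) undescribed-∈ ∷ undescribed-unique
    ; undescribed-∈          = Any.here refl ∷ All.map Any.there undescribed-∈
    ; undescribed-¬described = ¬described ∷ undescribed-¬described
    ; descriptions           = descriptions
    ; descriptions-unique    = descriptions-unique
    ; descriptions-describe  = All.map (map₂ (map₁ Any.there)) descriptions-describe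
    ; length-partition       = cong suc length-partition
    }
    where open Partition P

¬¬-All-Dec : ∀ {A : Set} {P : A → Set} xs → ¬ ¬ All (Dec ∘ P) xs
¬¬-All-Dec xs = All.sequenceM 0ℓ ¬¬-Monad (All.universal (λ _ → ¬¬-excluded-middle) xs)

ShortProgram : Enumeration → Str → ℕ → Str → Str → Set
ShortProgram T y n p x = length p < n × UComputes T ⟨ p , y ⟩ x

¬short⇒CGeq : ∀ T {y n x} → ¬ Described (ShortProgram T y n) x → CGeq T x y n
¬short⇒CGeq T {n = n} ¬short p comp =
  decidable-stable (n ≤? length p) (λ n≰p → ¬short (p , ≰⇒> n≰p , comp))

IncompressibleList : Enumeration → Str → ℕ → ℕ → Set
IncompressibleList T y n k =
  Σ (List Str) λ xs → Unique xs × All (λ x → length x ≡ n × CGeq T x y n) xs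
    × (∀ m → k + m < n → 2 ^ m ≤ length xs)

incompressible-many : ∀ T {i} → T i ≡ loop → ∀ y n →
  ¬ ¬ IncompressibleList T y n (length (bar (natStr i)))
incompressible-many T {i} Ti≡loop y n = ¬¬-map fromDecisions (¬¬-All-Dec (strings n))
  where
  fromDecisions : All (Dec ∘ Described (ShortProgram T y n)) (strings n) →
                  IncompressibleList T y n (length (bar (natStr i)))
  fromDecisions decisions =
    undescribed , undescribed-unique ,
    All.zip (All.map (All.lookup (strings-length n)) undescribed-∈ ,
             All.map (¬short⇒CGeq T) undescribed-¬described) ,
    bound
    where
    open Partition (partition (ShortProgram T y n) (λ (_ , c) (_ , c′) → UComputes-functional T c c′)
                              (strings-unique n) decisions)
    avoids-loop : ∀ {p} → (∃ λ x → x ∈ strings n × ShortProgram T y n p x) →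
                  length p < n × (∀ w → p ≢ bar (natStr i) ++ w)
    avoids-loop (_ , _ , p<n , comp) =
      p<n , λ { _ refl → ¬UComputes-loopPrefixed T {i} Ti≡loop comp }
    bound : ∀ m → length (bar (natStr i)) + m < n → 2 ^ m ≤ length undescribed
    bound m k+m<n = +-cancelˡ-≤ (length descriptions) _ _ (begin
      length descriptions + 2 ^ m
        ≤⟨ prefix-avoiding-bound (bar (natStr i)) k+m<n descriptions-unique
                                 (All.map avoids-loop descriptions-describe) ⟩
      2 ^ n                                    ≡⟨ length-strings n ⟨
      length (strings n)                       ≡⟨ length-partition ⟨
      length undescribed + length descriptions ≡⟨ +-comm (length undescribed) _ ⟩
      length descriptions + length undescribed ∎)
      where open ≤-Reasoning

2^n/2^[1+k]≤ : ∀ k n {b} .{{_ : NonZero (2 ^ suc k)}} →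
               (∀ m → k + m < n → 2 ^ m ≤ b) → 2 ^ n / 2 ^ suc k ≤ b
2^n/2^[1+k]≤ k n {b} bound with suc k ≤? n
... | no 1+k≰n =
  ≤-trans (≤-reflexive (m<n⇒m/n≡0 (^-monoʳ-< 2 (s≤s (s≤s z≤n)) (≰⇒> 1+k≰n)))) z≤n
... | yes 1+k≤n = begin
  2 ^ n / 2 ^ suc k              ≡⟨ cong (λ e → 2 ^ e / 2 ^ suc k) (m∸n+n≡m 1+k≤n) ⟨
  2 ^ (m + suc k) / 2 ^ suc k    ≡⟨ cong (_/ 2 ^ suc k) (^-distribˡ-+-* 2 m (suc k)) ⟩
  2 ^ m * 2 ^ suc k / 2 ^ suc k  ≡⟨ m*n/n≡m (2 ^ m) (2 ^ suc k) ⟩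
  2 ^ m                          ≤⟨ bound m (≤-reflexive (m+[n∸m]≡n 1+k≤n)) ⟩
  b                              ∎
  where
  open ≤-Reasoning
  m : ℕ
  m = n ∸ suc k

theorem1 : (T : Enumeration) → EnumeratesAll T →
    (Σ ℕ λ d → Σ (NonZero d) λ nz → (n : ℕ) → ManyIncompressible T d {{nz}} n (natStr n))
    × (Σ ℕ λ d → Σ (NonZero d) λ nz → (n : ℕ) → ManyIncompressible T d {{nz}} n [])
theorem1 T enumerates with enumerates loop
... | i , Ti≡loop =
  (2 ^ suc k , 2^[1+k]≢0 , λ n → many (natStr n) n) , (2 ^ suc k , 2^[1+k]≢0 , many [])
  where
  k : ℕ
  k = length (bar (natStr i))
  2^[1+k]≢0 : NonZero (2 ^ suc k)
  2^[1+k]≢0 = m^n≢0 2 (suc k)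
  many : ∀ y n → ManyIncompressible T (2 ^ suc k) {{2^[1+k]≢0}} n y
  many y n = ¬¬-map (map₂ (map₂ (map₂ (2^n/2^[1+k]≤ k n {{2^[1+k]≢0}}))))
                    (incompressible-many T Ti≡loop y n)
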